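{- Let $n\ge 1$ and let $\mathcal{E}$ be a family of $n$ pairwise edge-disjoint nonempty subgraphs of $K_{n+1}$. If $\mathcal{E}$ has no rainbow cycle, then $\mathcal{E}$ has a monochromatic cut, that is, a partition $V(\bigcup\mathcal{E})=V_1\cup V_2$ such that exactly one member of $\mathcal{E}$ has at least one edge between $V_1$ and $V_2$.
   Context: Subgraphs are regarded as edge sets; nonempty means having at least one edge; $V(\bigcup\mathcal{E})$ is the vertex set spanned by the union of members of $\mathcal{E}$. Given a family $\mathcal{E}$ of edge sets, an $\mathcal{E}$-rainbow set is a set $R\subseteq\bigcup\mathcal{E}$ with an injection $\sigma:R\to\mathcal{E}$ such that $e\in\sigma(e)$ for all $e\in R$; a rainbow cycle is a rainbow set forming a cycle (of length at least $3$). -}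

module Defs where

open import Data.Nat using (ℕ; zero; suc; _≥_)
open import Data.Fin using (Fin; zero; suc)
open import Data.Bool using (Bool; true; false)
open import Data.Product using (Σ; ∃; _×_; _,_)
open import Relation.Binary.PropositionalEquality using (_≡_; _≢_)
open import Function.Definitions using (Injective)

-- A subgraph of the complete graph K_m on vertex set Fin m, regarded as an
-- edge set: G u v ≡ true means the (unordered) edge uv belongs to G.
Subgraph : ℕ → Set
Subgraph m = Fin m → Fin m → Bool

IsEdgeSet : ∀ {m} → Subgraph m → Set
IsEdgeSet {m} G = (∀ (u : Fin m) → G u u ≡ false)
                × (∀ (u v : Fin m) → G u v ≡ G v u)

Nonempty : ∀ {m} → Subgraph m → Set
Nonempty {m} G = Σ (Fin m) λ u → Σ (Fin m) λ v → G u v ≡ true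

PairwiseEdgeDisjoint : ∀ {k m} → (Fin k → Subgraph m) → Set
PairwiseEdgeDisjoint {k} {m} E =
  ∀ (c d : Fin k) → c ≢ d → ∀ (u v : Fin m) → E c u v ≡ true → E d u v ≡ false

next : ∀ {m} → Fin (suc m) → Fin (suc m)
next {zero} zero = zero
next {suc m} zero = suc zero
next {suc m} (suc i) with next {m} i
... | zero = zero
... | suc j = suc (suc j)

-- A rainbow cycle of length k ≥ 3: distinct vertices v 0, …, v (k-1),
-- cycle edges v i — v (i+1 mod k), and an injective colour assignment σ
-- with the i-th cycle edge belonging to the member σ i.
-- (Cycle edges are pairwise distinct since k ≥ 3 and the vertices are
-- distinct, so injectivity on positions is injectivity on edges.)
RainbowCycle : ∀ {n m} → (Fin n → Subgraph m) → Set
RainbowCycle {n} {m} E =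
  Σ ℕ λ k →
  Σ (Fin (suc (suc (suc k))) → Fin m) λ v →
  Σ (Fin (suc (suc (suc k))) → Fin n) λ σ →
    Injective _≡_ _≡_ v × Injective _≡_ _≡_ σ
    × (∀ i → E (σ i) (v i) (v (next i)) ≡ true)

HasCrossingEdge : ∀ {m} → Subgraph m → (Fin m → Bool) → Set
HasCrossingEdge {m} G S =
  Σ (Fin m) λ u → Σ (Fin m) λ v → (G u v ≡ true) × (S u ≡ true) × (S v ≡ false)

MonochromaticCut : ∀ {n m} → (Fin n → Subgraph m) → Set
MonochromaticCut {n} {m} E =
  Σ (Fin m → Bool) λ S → Σ (Fin n) λ c →
    HasCrossingEdge (E c) S × (∀ d → HasCrossingEdge (E d) S → d ≡ c)

module Submission where

-- Contracting an edge uv of a member c and discarding c preserves all hypotheses: a member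
-- acquiring a loop would share the edge uv with c, two members acquiring a common edge give
-- a rainbow triangle through uv, and a rainbow cycle of the contraction lifts to one of the
-- original family, closed up by uv ∈ c where it passes through the merged vertex. Iterating,
-- n nonempty members on n vertices always contain a rainbow cycle. With n members on n + 1
-- vertices, deleting any vertex w leaves such a family, so some member has all its edges at w;
-- by pigeonhole one member is a single edge w₁w₂, and a monochromatic cut of the family with
-- w₁w₂ contracted pulls back to one of the original family.

open import Defs
open import Data.Nat using (ℕ; zero; suc; _≥_; _≤_; z≤n; s≤s)
open import Data.Nat.Properties using (suc-injective; n<1+n)
open import Data.Fin using (Fin; zero; suc; fromℕ; inject₁; punchIn; punchOut; _≟_; _<_)
open import Data.Fin.Properties
  using (punchInᵢ≢i; punchIn-punchOut; punchOut-punchIn; punchOut-cong; punchIn-injective; any?;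
         ¬∀⟶∃¬; pigeonhole; <⇒≢)
open import Data.Bool using (true; false)
open import Data.Product using (∃; ∃₂; _×_; _,_; proj₁; proj₂)
open import Data.Sum using (_⊎_; inj₁; inj₂)
open import Data.Unit using (⊤; tt)
open import Data.Empty using (⊥; ⊥-elim)
open import Data.List using (List; []; _∷_; _++_; map; length; lookup; tabulate)
open import Data.List.Properties using (map-tabulate; tabulate-lookup; map-∘; length-map)
open import Data.List.Relation.Unary.All as All using (All; []; _∷_)
import Data.List.Relation.Unary.All.Properties as All
open import Data.List.Relation.Unary.AllPairs using ([]; _∷_)
open import Data.List.Relation.Unary.Unique.Propositional using (Unique)
import Data.List.Relation.Unary.Unique.Propositional.Properties as Unique
open import Data.List.Membership.Propositional using (_∈_)
open import Data.List.Membership.Propositional.Properties using (∈-lookup; ∈-∃++; ∈-map⁻)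
import Data.List.Relation.Unary.Any as Any
open import Data.List.Relation.Binary.Permutation.Propositional using (_↭_; ↭-sym; ↭⇒↭ₛ)
open import Data.List.Relation.Binary.Permutation.Propositional.Properties using (++-comm; ↭-length)
import Data.List.Relation.Binary.Permutation.Propositional.Properties as ↭
import Data.List.Relation.Binary.Permutation.Setoid.Properties as ↭ₛ
open import Relation.Binary.PropositionalEquality
  using (_≡_; _≢_; refl; sym; trans; cong; subst; subst₂; setoid; module ≡-Reasoning)
open import Relation.Nullary using (¬_; Dec; yes; no; does)
open import Relation.Nullary.Decidable using (_×-dec_; dec-true; dec-false; does-⇔)
open import Function.Bundles using (mk⇔)
import Data.Bool.Properties as Bool

private
  variable
    A B : Set
    m n : ℕ

edge⇒≢ : {G : Subgraph m} → IsEdgeSet G → ∀ {x y} → G x y ≡ true → x ≢ y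
edge⇒≢ (loopless , _) {x} Gxy refl with trans (sym Gxy) (loopless x)
... | ()

edge-sym : {G : Subgraph m} → IsEdgeSet G → ∀ {x y} → G x y ≡ true → G y x ≡ true
edge-sym (_ , symmetric) {x} {y} Gxy = trans (symmetric y x) Gxy

SameEdge : Fin m → Fin m → Fin m → Fin m → Set
SameEdge u v x y = (x ≡ u × y ≡ v) ⊎ (x ≡ v × y ≡ u)

IsSingleEdge : Subgraph m → Fin m → Fin m → Set
IsSingleEdge G u v = u ≢ v × G u v ≡ true × (∀ {x y} → G x y ≡ true → SameEdge u v x y)

does≡true⇒ : {P : Set} (p? : Dec P) → does p? ≡ true → P
does≡true⇒ (yes p) _ = p
does≡true⇒ (no _) ()

Unique-resp-↭ : {xs ys : List A} → xs ↭ ys → Unique xs → Unique ys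
Unique-resp-↭ {A} xs↭ys = ↭ₛ.Unique-resp-↭ (setoid A) (↭⇒↭ₛ xs↭ys)

Unique-map⇒lookup-injective : (f : A → B) (xs : List A) → Unique (map f xs) →
  ∀ {i j} → f (lookup xs i) ≡ f (lookup xs j) → i ≡ j
Unique-map⇒lookup-injective f (x ∷ xs) (_ ∷ _) {zero} {zero} _ = refl
Unique-map⇒lookup-injective f (x ∷ xs) (fx∉ ∷ _) {zero} {suc j} eq =
  ⊥-elim (All.lookup (All.map⁻ fx∉) (∈-lookup j) eq)
Unique-map⇒lookup-injective f (x ∷ xs) (fx∉ ∷ _) {suc i} {zero} eq =
  ⊥-elim (All.lookup (All.map⁻ fx∉) (∈-lookup i) (sym eq))
Unique-map⇒lookup-injective f (x ∷ xs) (_ ∷ unique) {suc i} {suc j} eq =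
  cong suc (Unique-map⇒lookup-injective f xs unique eq)

-- A step (x , d) of a walk leaves the vertex x along an edge of member d.
Step : ℕ → ℕ → Set
Step m n = Fin m × Fin n

StepsTo : (Fin n → Subgraph m) → Step m n → Fin m → Set
StepsTo E (x , d) y = E d x y ≡ true

start : List (Step m n) → Fin m → Fin m
start [] e = e
start ((x , _) ∷ _) e = x

Walk : (Fin n → Subgraph m) → List (Step m n) → Fin m → Set
Walk E [] e = ⊤
Walk E (t ∷ ts) e = StepsTo E t (start ts e) × Walk E ts e

start-++ : (as bs : List (Step m n)) (e : Fin m) → start (as ++ bs) e ≡ start as (start bs e)
start-++ [] bs e = refl
start-++ (_ ∷ _) bs e = refl

module _ (E : Fin n → Subgraph m) where

  walk-++⁻ : ∀ as bs e → Walk E (as ++ bs) e → Walk E as (start bs e) × Walk E bs e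
  walk-++⁻ [] bs e walk = tt , walk
  walk-++⁻ (t ∷ as) bs e (step , walk) =
    (subst (StepsTo E t) (start-++ as bs e) step , proj₁ (walk-++⁻ as bs e walk)) ,
    proj₂ (walk-++⁻ as bs e walk)

  walk-++⁺ : ∀ as bs e → Walk E as (start bs e) → Walk E bs e → Walk E (as ++ bs) e
  walk-++⁺ [] bs e _ walk = walk
  walk-++⁺ (t ∷ as) bs e (step , walkₐ) walkᵦ =
    subst (StepsTo E t) (sym (start-++ as bs e)) step , walk-++⁺ as bs e walkₐ walkᵦ

  -- List form of RainbowCycle, which is easier to rotate and to lift through a contraction.
  record RainbowCycleFrom (t : Step m n) : Set where
    constructor rainbowCycleFrom
    field
      rest : List (Step m n)
      long : 2 ≤ length rest
      distinctVertices : Unique (map proj₁ (t ∷ rest))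
      distinctColours : Unique (map proj₂ (t ∷ rest))
      closed : Walk E (t ∷ rest) (proj₁ t)

  rotate : ∀ {t₀ t} (C : RainbowCycleFrom t₀) → t ∈ t₀ ∷ RainbowCycleFrom.rest C → RainbowCycleFrom t
  rotate {t₀} {t} (rainbowCycleFrom rest long vs cs walk) t∈ with ∈-∃++ t∈
  ... | as , bs , eq = rainbowCycleFrom (bs ++ as)
    (subst (2 ≤_) (suc-injective (trans (cong length eq) (↭-length (↭-sym rotation)))) long)
    (distinct proj₁ vs) (distinct proj₂ cs)
    (walk-++⁺ (t ∷ bs) as (proj₁ t) (proj₂ split) (proj₁ split))
    where
    rotation : t ∷ bs ++ as ↭ as ++ t ∷ bs
    rotation = ++-comm (t ∷ bs) as

    distinct : (f : Step m n → A) → Unique (map f (t₀ ∷ rest)) → Unique (map f (t ∷ bs ++ as))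
    distinct f unique =
      Unique-resp-↭ (↭.map⁺ f (↭-sym rotation)) (subst (λ ts → Unique (map f ts)) eq unique)

    start≡ : proj₁ t₀ ≡ start as (proj₁ t)
    start≡ = trans (cong (λ ts → start ts (proj₁ t)) eq) (start-++ as (t ∷ bs) (proj₁ t))

    split : Walk E as (proj₁ t) × Walk E (t ∷ bs) (start as (proj₁ t))
    split = walk-++⁻ as (t ∷ bs) _ (subst₂ (Walk E) eq start≡ walk)

next-fromℕ : ∀ j → next (fromℕ j) ≡ zero
next-fromℕ zero = refl
next-fromℕ (suc j) rewrite next-fromℕ j = refl

next-inject₁ : ∀ {j} (i : Fin j) → next (inject₁ i) ≡ suc i
next-inject₁ {suc j} zero = refl
next-inject₁ {suc j} (suc i) rewrite next-inject₁ i = refl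

data LastOrInject₁ : ∀ j → Fin (suc j) → Set where
  last : ∀ {j} → LastOrInject₁ j (fromℕ j)
  inner : ∀ {j} (i : Fin j) → LastOrInject₁ j (inject₁ i)

lastOrInject₁ : ∀ j (i : Fin (suc j)) → LastOrInject₁ j i
lastOrInject₁ zero zero = last
lastOrInject₁ (suc j) zero = inner zero
lastOrInject₁ (suc j) (suc i) with lastOrInject₁ j i
... | last = last
... | inner i′ = inner (suc i′)

module _ (E : Fin n → Subgraph m) where

  walk-tabulate⁺ : ∀ j (g : Fin (suc j) → Step m n) e →
    (∀ i → StepsTo E (g (inject₁ i)) (proj₁ (g (suc i)))) → StepsTo E (g (fromℕ j)) e →
    Walk E (tabulate g) e
  walk-tabulate⁺ zero g e _ final = final , tt
  walk-tabulate⁺ (suc j) g e internal final =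
    internal zero , walk-tabulate⁺ j (λ i → g (suc i)) e (λ i → internal (suc i)) final

  walk-tabulate⁻ : ∀ j (g : Fin (suc j) → Step m n) e → Walk E (tabulate g) e →
    (∀ i → StepsTo E (g (inject₁ i)) (proj₁ (g (suc i)))) × StepsTo E (g (fromℕ j)) e
  walk-tabulate⁻ zero g e (final , _) = (λ ()) , final
  walk-tabulate⁻ (suc j) g e (step , walk) with walk-tabulate⁻ j (λ i → g (suc i)) e walk
  ... | internal , final = (λ { zero → step ; (suc i) → internal i }) , final

  cyclic⇒walk : ∀ j (g : Fin (suc j) → Step m n) →
    (∀ i → StepsTo E (g i) (proj₁ (g (next i)))) → Walk E (tabulate g) (proj₁ (g zero))
  cyclic⇒walk j g cyclic = walk-tabulate⁺ j g _
    (λ i → subst (λ i′ → StepsTo E (g (inject₁ i)) (proj₁ (g i′))) (next-inject₁ i) (cyclic (inject₁ i)))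
    (subst (λ i′ → StepsTo E (g (fromℕ j)) (proj₁ (g i′))) (next-fromℕ j) (cyclic (fromℕ j)))

  walk⇒cyclic : ∀ j (g : Fin (suc j) → Step m n) →
    Walk E (tabulate g) (proj₁ (g zero)) → ∀ i → StepsTo E (g i) (proj₁ (g (next i)))
  walk⇒cyclic j g walk i with walk-tabulate⁻ j g _ walk | lastOrInject₁ j i
  ... | _ , final | last rewrite next-fromℕ j = final
  ... | internal , _ | inner i′ rewrite next-inject₁ i′ = internal i′

  fromRainbowCycle : RainbowCycle E → ∃ (RainbowCycleFrom E)
  fromRainbowCycle (k , v , σ , v-injective , σ-injective , steps) =
    g zero , rainbowCycleFrom (tabulate (λ i → g (suc i))) (s≤s (s≤s z≤n))
      (subst Unique (sym (map-tabulate g proj₁)) (Unique.tabulate⁺ v-injective))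
      (subst Unique (sym (map-tabulate g proj₂)) (Unique.tabulate⁺ σ-injective))
      (cyclic⇒walk (suc (suc k)) g steps)
    where
    g : Fin (suc (suc (suc k))) → Step m n
    g i = v i , σ i

  toRainbowCycle : ∀ {t} → RainbowCycleFrom E t → RainbowCycle E
  toRainbowCycle (rainbowCycleFrom (_ ∷ []) (s≤s ()) _ _ _)
  toRainbowCycle {t} (rainbowCycleFrom (t₁ ∷ t₂ ∷ rest) _ vs cs walk) =
    length rest , (λ i → proj₁ (lookup ts i)) , (λ i → proj₂ (lookup ts i)) ,
    Unique-map⇒lookup-injective proj₁ ts vs , Unique-map⇒lookup-injective proj₂ ts cs ,
    walk⇒cyclic (suc (suc (length rest))) (lookup ts)
      (subst (λ ts′ → Walk E ts′ (proj₁ t)) (sym (tabulate-lookup ts)) walk)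
    where
    ts : List (Step m n)
    ts = t ∷ t₁ ∷ t₂ ∷ rest

  rainbowTriangle : ∀ {a b c α β γ} → a ≢ b → b ≢ c → a ≢ c → α ≢ β → β ≢ γ → α ≢ γ →
    E α a b ≡ true → E β b c ≡ true → E γ c a ≡ true → RainbowCycle E
  rainbowTriangle a≢b b≢c a≢c α≢β β≢γ α≢γ ab bc ca =
    toRainbowCycle (rainbowCycleFrom ((_ , _) ∷ (_ , _) ∷ []) (s≤s (s≤s z≤n))
      ((a≢b ∷ a≢c ∷ []) ∷ (b≢c ∷ []) ∷ [] ∷ [])
      ((α≢β ∷ α≢γ ∷ []) ∷ (β≢γ ∷ []) ∷ [] ∷ [])
      (ab , bc , ca , tt))

-- Contraction of the edge uv of member c: merge identifies v with u, member c is dropped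
-- and the others keep their order via punchIn c.
module Contraction {k m} (E : Fin (suc k) → Subgraph (suc m)) (c : Fin (suc k))
                   {u v : Fin (suc m)} (u≢v : u ≢ v) where

  open ≡-Reasoning

  merged : Fin m
  merged = punchOut {i = v} (λ v≡u → u≢v (sym v≡u))

  merge : Fin (suc m) → Fin m
  merge x with v ≟ x
  ... | yes _ = merged
  ... | no v≢x = punchOut v≢x

  merge-punchIn : ∀ y → merge (punchIn v y) ≡ y
  merge-punchIn y with v ≟ punchIn v y
  ... | yes v≡ = ⊥-elim (punchInᵢ≢i v y (sym v≡))
  ... | no _ = trans (punchOut-cong v refl) (punchOut-punchIn v)

  merge-v : merge v ≡ merged
  merge-v with v ≟ v
  ... | yes _ = refl
  ... | no v≢v = ⊥-elim (v≢v refl)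

  merge-u : merge u ≡ merged
  merge-u with v ≟ u
  ... | yes _ = refl
  ... | no _ = punchOut-cong v refl

  punchIn-merge : ∀ {x} → x ≢ v → punchIn v (merge x) ≡ x
  punchIn-merge {x} x≢v with v ≟ x
  ... | yes v≡x = ⊥-elim (x≢v (sym v≡x))
  ... | no v≢x = punchIn-punchOut v≢x

  punchIn-merged : punchIn v merged ≡ u
  punchIn-merged = punchIn-punchOut _

  merge-fiber : ∀ {x y} → merge x ≡ y → merged ≢ y → x ≡ punchIn v y
  merge-fiber {x} refl merged≢y with x ≟ v
  ... | yes refl = ⊥-elim (merged≢y (sym merge-v))
  ... | no x≢v = sym (punchIn-merge x≢v)

  merge-collision : ∀ {x y} → merge x ≡ merge y → x ≢ y → SameEdge u v x y
  merge-collision {x} {y} eq x≢y with x ≟ v | y ≟ v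
  ... | yes refl | yes refl = ⊥-elim (x≢y refl)
  ... | yes refl | no y≢v = inj₂ (refl , sym (begin
    u                  ≡⟨ sym punchIn-merged ⟩
    punchIn v merged   ≡⟨ cong (punchIn v) (trans (sym merge-v) eq) ⟩
    punchIn v (merge y) ≡⟨ punchIn-merge y≢v ⟩
    y                  ∎))
  ... | no x≢v | yes refl = inj₁ (sym (begin
    u                  ≡⟨ sym punchIn-merged ⟩
    punchIn v merged   ≡⟨ cong (punchIn v) (trans (sym merge-v) (sym eq)) ⟩
    punchIn v (merge x) ≡⟨ punchIn-merge x≢v ⟩
    x                  ∎) , refl)
  ... | no x≢v | no y≢v =
    ⊥-elim (x≢y (trans (sym (punchIn-merge x≢v)) (trans (cong (punchIn v) eq) (punchIn-merge y≢v))))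

  sameEdge⇒merge≡merged : ∀ {x y} → SameEdge u v x y → merge x ≡ merged
  sameEdge⇒merge≡merged (inj₁ (refl , _)) = merge-u
  sameEdge⇒merge≡merged (inj₂ (refl , _)) = merge-v

  sameEdge⇒merge≡ : ∀ {x y} → SameEdge u v x y → merge x ≡ merge y
  sameEdge⇒merge≡ (inj₁ (refl , refl)) = trans merge-u (sym merge-v)
  sameEdge⇒merge≡ (inj₂ (refl , refl)) = trans merge-v (sym merge-u)

  liftStep : Step m k → Step (suc m) (suc k)
  liftStep (y , d) = punchIn v y , punchIn c d

  Preimage : Fin k → Fin m → Fin m → Set
  Preimage d y₁ y₂ = ∃₂ λ x₁ x₂ → merge x₁ ≡ y₁ × merge x₂ ≡ y₂ × E (punchIn c d) x₁ x₂ ≡ true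

  preimage? : ∀ d y₁ y₂ → Dec (Preimage d y₁ y₂)
  preimage? d y₁ y₂ = any? λ x₁ → any? λ x₂ →
    merge x₁ ≟ y₁ ×-dec merge x₂ ≟ y₂ ×-dec E (punchIn c d) x₁ x₂ Bool.≟ true

  Contracted : Fin k → Subgraph m
  Contracted d y₁ y₂ = does (preimage? d y₁ y₂)

  contracted⁺ : ∀ {d x₁ x₂} → E (punchIn c d) x₁ x₂ ≡ true → Contracted d (merge x₁) (merge x₂) ≡ true
  contracted⁺ {d} {x₁} {x₂} edge = dec-true (preimage? d _ _) (x₁ , x₂ , refl , refl , edge)

  contracted⁻ : ∀ {d y₁ y₂} → Contracted d y₁ y₂ ≡ true → Preimage d y₁ y₂
  contracted⁻ {d} {y₁} {y₂} = does≡true⇒ (preimage? d y₁ y₂)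

  contracted⁻ˡ : ∀ {d y₁ y₂} → Contracted d y₁ y₂ ≡ true → merged ≢ y₁ →
    ∃ λ x₂ → merge x₂ ≡ y₂ × E (punchIn c d) (punchIn v y₁) x₂ ≡ true
  contracted⁻ˡ edge merged≢y₁ with contracted⁻ edge
  ... | x₁ , x₂ , refl , m₂ , edge′ = x₂ , m₂ , subst (λ x → E _ x x₂ ≡ true) (merge-fiber refl merged≢y₁) edge′

  contracted⁻ʳ : ∀ {d y₁ y₂} → Contracted d y₁ y₂ ≡ true → merged ≢ y₂ →
    ∃ λ x₁ → merge x₁ ≡ y₁ × E (punchIn c d) x₁ (punchIn v y₂) ≡ true
  contracted⁻ʳ edge merged≢y₂ with contracted⁻ edge
  ... | x₁ , x₂ , m₁ , refl , edge′ = x₁ , m₁ , subst (λ x → E _ x₁ x ≡ true) (merge-fiber refl merged≢y₂) edge′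

  contracted-nonempty : ∀ d → Nonempty (E (punchIn c d)) → Nonempty (Contracted d)
  contracted-nonempty d (x₁ , x₂ , edge) = merge x₁ , merge x₂ , contracted⁺ edge

  lifted-vertices : ∀ ts → map proj₁ (map liftStep ts) ≡ map (punchIn v) (map proj₁ ts)
  lifted-vertices ts = trans (sym (map-∘ ts)) (map-∘ ts)

  lifted-colours : ∀ ts → map proj₂ (map liftStep ts) ≡ map (punchIn c) (map proj₂ ts)
  lifted-colours ts = trans (sym (map-∘ ts)) (map-∘ ts)

  unique-lifted-vertices : ∀ ts → Unique (map proj₁ ts) → Unique (map proj₁ (map liftStep ts))
  unique-lifted-vertices ts unique =
    subst Unique (sym (lifted-vertices ts)) (Unique.map⁺ (punchIn-injective v _ _) unique)

  unique-lifted-colours : ∀ ts → Unique (map proj₂ ts) → Unique (map proj₂ (map liftStep ts))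
  unique-lifted-colours ts unique =
    subst Unique (sym (lifted-colours ts)) (Unique.map⁺ (punchIn-injective c _ _) unique)

  merged-fiber∉lifted : ∀ {x} → merge x ≡ merged → ∀ ts → All (merged ≢_) (map proj₁ ts) →
    All (x ≢_) (map proj₁ (map liftStep ts))
  merged-fiber∉lifted {x} x↦merged ts avoid =
    subst (All (x ≢_)) (sym (lifted-vertices ts)) (All.map⁺ (All.map x≢punchIn avoid))
    where
    x≢punchIn : ∀ {y} → merged ≢ y → x ≢ punchIn v y
    x≢punchIn {y} merged≢y refl = merged≢y (trans (sym x↦merged) (merge-punchIn y))

  c∉lifted : ∀ ts → All (c ≢_) (map proj₂ (map liftStep ts))
  c∉lifted ts = subst (All (c ≢_)) (sym (lifted-colours ts))
    (All.map⁺ (All.universal (λ d c≡ → punchInᵢ≢i c d (sym c≡)) (map proj₂ ts)))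

  liftWalk : ∀ t ts e → All (merged ≢_) (map proj₁ (t ∷ ts)) → Walk Contracted (t ∷ ts) e →
    ∃ λ x → merge x ≡ e × Walk E (map liftStep (t ∷ ts)) x
  liftWalk t [] e (avoid ∷ []) (step , _) with contracted⁻ˡ step avoid
  ... | x , x↦e , step′ = x , x↦e , step′ , tt
  liftWalk t (t′ ∷ ts) e (avoid ∷ avoids) (step , walk)
    with liftWalk t′ ts e avoids walk | contracted⁻ˡ step avoid
  ... | x , x↦e , walk′ | x₂ , x₂↦ , step′ =
    x , x↦e , subst (λ w → E _ _ w ≡ true) (merge-fiber x₂↦ (All.head avoids)) step′ , walk′

  liftCycle-avoiding : ∀ {t} (C : RainbowCycleFrom Contracted t) →
    All (merged ≢_) (map proj₁ (t ∷ RainbowCycleFrom.rest C)) → RainbowCycleFrom E (liftStep t)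
  liftCycle-avoiding {t} (rainbowCycleFrom rest long vs cs walk) avoid
    with liftWalk t rest (proj₁ t) avoid walk
  ... | x , x↦t , walk′ = rainbowCycleFrom (map liftStep rest)
    (subst (2 ≤_) (sym (length-map liftStep rest)) long)
    (unique-lifted-vertices (t ∷ rest) vs) (unique-lifted-colours (t ∷ rest) cs)
    (subst (Walk E (map liftStep (t ∷ rest))) (merge-fiber x↦t (All.head avoid)) walk′)

  module Properties (isEdgeSet : ∀ d → IsEdgeSet (E d)) (disjoint : PairwiseEdgeDisjoint E)
                    (rainbowFree : ¬ RainbowCycle E) (uv∈c : E c u v ≡ true) where

    uv-edge : ∀ {x y} → SameEdge u v x y → E c x y ≡ true
    uv-edge (inj₁ (refl , refl)) = uv∈c
    uv-edge (inj₂ (refl , refl)) = edge-sym (isEdgeSet c) uv∈c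

    clash : ∀ {a b x y} → a ≢ b → E a x y ≡ true → E b x y ≡ true → ⊥
    clash {a} {b} {x} {y} a≢b edgeᵃ edgeᵇ with trans (sym edgeᵇ) (disjoint a b a≢b x y edgeᵃ)
    ... | ()

    c≢punchIn : ∀ d → c ≢ punchIn c d
    c≢punchIn d c≡ = punchInᵢ≢i c d (sym c≡)

    contracted-isEdgeSet : ∀ d → IsEdgeSet (Contracted d)
    contracted-isEdgeSet d = loopless , symmetric
      where
      loopless : ∀ y → Contracted d y y ≡ false
      loopless y = dec-false (preimage? d y y) λ (x₁ , x₂ , x₁↦y , x₂↦y , edge) →
        clash (c≢punchIn d)
          (uv-edge (merge-collision (trans x₁↦y (sym x₂↦y)) (edge⇒≢ (isEdgeSet _) edge))) edge

      swap : ∀ {y₁ y₂} → Preimage d y₁ y₂ → Preimage d y₂ y₁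
      swap (x₁ , x₂ , x₁↦ , x₂↦ , edge) = x₂ , x₁ , x₂↦ , x₁↦ , edge-sym (isEdgeSet _) edge

      symmetric : ∀ y₁ y₂ → Contracted d y₁ y₂ ≡ Contracted d y₂ y₁
      symmetric y₁ y₂ = does-⇔ (mk⇔ swap swap) (preimage? d y₁ y₂) (preimage? d y₂ y₁)

    -- Two edges of distinct members ending at a common vertex y, whose other ends x, x′
    -- are merged, close up with the edge x′x ∈ c into a rainbow triangle.
    rainbowTriangle-at-uv : ∀ {d e x x′ y} → punchIn c d ≢ punchIn c e → x ≢ x′ → merge x ≡ merge x′ →
      E (punchIn c d) x y ≡ true → E (punchIn c e) x′ y ≡ true → ⊥
    rainbowTriangle-at-uv {d} {e} d≢e x≢x′ x≈x′ edge edge′ = rainbowFree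
      (rainbowTriangle E (edge⇒≢ (isEdgeSet _) edge) (edge⇒≢ (isEdgeSet _) (edge-sym (isEdgeSet _) edge′))
        x≢x′ d≢e (λ e≡c → c≢punchIn e (sym e≡c)) (λ d≡c → c≢punchIn d (sym d≡c))
        edge (edge-sym (isEdgeSet _) edge′)
        (uv-edge (merge-collision (sym x≈x′) (λ x′≡x → x≢x′ (sym x′≡x)))))

    contracted-disjoint : PairwiseEdgeDisjoint Contracted
    contracted-disjoint d e d≢e y₁ y₂ edge =
      dec-false (preimage? e y₁ y₂) (excluded (contracted⁻ edge))
      where
      lifted-d≢e : punchIn c d ≢ punchIn c e
      lifted-d≢e eq = d≢e (punchIn-injective c d e eq)

      excluded : Preimage d y₁ y₂ → ¬ Preimage e y₁ y₂
      excluded (x₁ , x₂ , x₁↦ , x₂↦ , g) (x₁′ , x₂′ , x₁′↦ , x₂′↦ , g′) with x₁ ≟ x₁′ | x₂ ≟ x₂′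
      ... | yes refl | yes refl = clash lifted-d≢e g g′
      ... | no x₁≢x₁′ | yes refl = rainbowTriangle-at-uv lifted-d≢e x₁≢x₁′ (trans x₁↦ (sym x₁′↦)) g g′
      ... | yes refl | no x₂≢x₂′ = rainbowTriangle-at-uv lifted-d≢e x₂≢x₂′ (trans x₂↦ (sym x₂′↦))
                                     (edge-sym (isEdgeSet _) g) (edge-sym (isEdgeSet _) g′)
      ... | no x₁≢x₁′ | no x₂≢x₂′ = edge⇒≢ (contracted-isEdgeSet d) edge (begin
        y₁       ≡⟨ sym x₁↦ ⟩
        merge x₁ ≡⟨ sameEdge⇒merge≡merged (merge-collision (trans x₁↦ (sym x₁′↦)) x₁≢x₁′) ⟩
        merged   ≡⟨ sym (sameEdge⇒merge≡merged (merge-collision (trans x₂↦ (sym x₂′↦)) x₂≢x₂′)) ⟩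
        merge x₂ ≡⟨ x₂↦ ⟩
        y₂       ∎)

    -- If the cycle enters and leaves the merged vertex at different ends of uv,
    -- the edge uv ∈ c closes the lifted path.
    liftCycle-through-merged : ∀ {d} → RainbowCycleFrom Contracted (merged , d) → ∃ (RainbowCycleFrom E)
    liftCycle-through-merged {d} (rainbowCycleFrom (t ∷ ts) long (merged∉ ∷ vs) cs (first , walk))
      with contracted⁻ʳ first (All.head merged∉) | liftWalk t ts merged merged∉ walk
    ... | x₁ , x₁↦ , first′ | x₀ , x₀↦ , walk′ with x₀ ≟ x₁
    ... | yes refl = (x₀ , punchIn c d) , rainbowCycleFrom (map liftStep (t ∷ ts))
      (subst (2 ≤_) (sym (length-map liftStep (t ∷ ts))) long)
      (merged-fiber∉lifted x₀↦ (t ∷ ts) merged∉ ∷ unique-lifted-vertices (t ∷ ts) vs)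
      (unique-lifted-colours ((merged , d) ∷ t ∷ ts) cs)
      (first′ , walk′)
    ... | no x₀≢x₁ = (x₀ , c) , rainbowCycleFrom ((x₁ , punchIn c d) ∷ map liftStep (t ∷ ts))
      (s≤s (s≤s z≤n))
      ((x₀≢x₁ ∷ merged-fiber∉lifted x₀↦ (t ∷ ts) merged∉) ∷
        merged-fiber∉lifted x₁↦ (t ∷ ts) merged∉ ∷ unique-lifted-vertices (t ∷ ts) vs)
      (c∉lifted ((merged , d) ∷ t ∷ ts) ∷ unique-lifted-colours ((merged , d) ∷ t ∷ ts) cs)
      (uv-edge (merge-collision (trans x₀↦ (sym x₁↦)) x₀≢x₁) , first′ , walk′)

    contracted-rainbowFree : ¬ RainbowCycle Contracted
    contracted-rainbowFree cycle with fromRainbowCycle Contracted cycle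
    ... | t , C with Any.any? (merged ≟_) (map proj₁ (t ∷ RainbowCycleFrom.rest C))
    ... | no merged∉ =
      rainbowFree (toRainbowCycle E (liftCycle-avoiding C (All.¬Any⇒All¬ _ merged∉)))
    ... | yes merged∈ with ∈-map⁻ proj₁ merged∈
    ...   | (_ , _) , t′∈ , refl =
      rainbowFree (toRainbowCycle E (proj₂ (liftCycle-through-merged (rotate Contracted C t′∈))))

  pullback-cut : (∀ {x y} → E c x y ≡ true → SameEdge u v x y) →
    MonochromaticCut Contracted → MonochromaticCut E
  pullback-cut only-uv (S , d , (y₁ , y₂ , edge , S₁ , S₂) , unique) with contracted⁻ edge
  ... | x₁ , x₂ , refl , refl , edge′ =
    (λ x → S (merge x)) , punchIn c d , (x₁ , x₂ , edge′ , S₁ , S₂) , onlyCrossing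
    where
    onlyCrossing : ∀ d′ → HasCrossingEdge (E d′) (λ x → S (merge x)) → d′ ≡ punchIn c d
    onlyCrossing d′ (z₁ , z₂ , edge″ , S₁′ , S₂′) with c ≟ d′
    ... | yes refl with trans (sym S₁′) (trans (cong S (sameEdge⇒merge≡ (only-uv edge″))) S₂′)
    ...   | ()
    onlyCrossing d′ (z₁ , z₂ , edge″ , S₁′ , S₂′) | no c≢d′ =
      trans (sym d′≡) (cong (punchIn c) (unique (punchOut c≢d′)
        (merge z₁ , merge z₂ , contracted⁺ (subst (λ d″ → E d″ z₁ z₂ ≡ true) (sym d′≡) edge″) , S₁′ , S₂′)))
      where
      d′≡ : punchIn c (punchOut c≢d′) ≡ d′
      d′≡ = punchIn-punchOut c≢d′

nonempty? : (G : Subgraph m) → Dec (Nonempty G)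
nonempty? G = any? λ x → any? λ y → G x y Bool.≟ true

deleteVertex : (Fin n → Subgraph (suc m)) → Fin (suc m) → Fin n → Subgraph m
deleteVertex E w d x y = E d (punchIn w x) (punchIn w y)

module _ (E : Fin n → Subgraph (suc m)) (w : Fin (suc m)) where

  deleteVertex-isEdgeSet : ∀ {d} → IsEdgeSet (E d) → IsEdgeSet (deleteVertex E w d)
  deleteVertex-isEdgeSet (loopless , symmetric) =
    (λ x → loopless (punchIn w x)) , (λ x y → symmetric (punchIn w x) (punchIn w y))

  deleteVertex-disjoint : PairwiseEdgeDisjoint E → PairwiseEdgeDisjoint (deleteVertex E w)
  deleteVertex-disjoint disjoint d e d≢e x y = disjoint d e d≢e (punchIn w x) (punchIn w y)

  deleteVertex-rainbowFree : ¬ RainbowCycle E → ¬ RainbowCycle (deleteVertex E w)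
  deleteVertex-rainbowFree rainbowFree (k , v , σ , v-injective , σ-injective , steps) =
    rainbowFree (k , (λ i → punchIn w (v i)) , σ ,
      (λ eq → v-injective (punchIn-injective w _ _ eq)) , σ-injective , steps)

  deleteVertex-empty⇒touches : ∀ {d} → ¬ Nonempty (deleteVertex E w d) →
    ∀ {x y} → E d x y ≡ true → x ≡ w ⊎ y ≡ w
  deleteVertex-empty⇒touches {d} empty {x} {y} edge with w ≟ x | w ≟ y
  ... | yes refl | _ = inj₁ refl
  ... | no _ | yes refl = inj₂ refl
  ... | no w≢x | no w≢y = ⊥-elim (empty (punchOut w≢x , punchOut w≢y ,
    subst₂ (λ x′ y′ → E d x′ y′ ≡ true) (sym (punchIn-punchOut w≢x)) (sym (punchIn-punchOut w≢y)) edge))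

-- Contracting an edge of one member keeps all hypotheses with one member and one vertex fewer.
rainbowCycle-forced : ∀ k (E : Fin (suc k) → Subgraph (suc k)) →
  (∀ c → IsEdgeSet (E c)) → (∀ c → Nonempty (E c)) → PairwiseEdgeDisjoint E → ¬ ¬ RainbowCycle E
rainbowCycle-forced zero E isEdgeSet nonempty _ _ with nonempty zero
... | zero , zero , edge = edge⇒≢ (isEdgeSet zero) edge refl
rainbowCycle-forced (suc k) E isEdgeSet nonempty disjoint rainbowFree with nonempty zero
... | u , v , uv∈ = rainbowCycle-forced k Contracted contracted-isEdgeSet
  (λ d → contracted-nonempty d (nonempty (punchIn zero d))) contracted-disjoint contracted-rainbowFree
  where
  open Contraction E zero (edge⇒≢ (isEdgeSet zero) uv∈)
  open Properties isEdgeSet disjoint rainbowFree uv∈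

deleteVertex-empties-member : ∀ k (E : Fin (suc k) → Subgraph (suc (suc k))) →
  (∀ c → IsEdgeSet (E c)) → PairwiseEdgeDisjoint E → ¬ RainbowCycle E →
  ∀ w → ∃ λ d → ¬ Nonempty (deleteVertex E w d)
deleteVertex-empties-member k E isEdgeSet disjoint rainbowFree w =
  ¬∀⟶∃¬ _ _ (λ d → nonempty? _) λ nonempty →
    rainbowCycle-forced k (deleteVertex E w) (λ d → deleteVertex-isEdgeSet E w (isEdgeSet d)) nonempty
      (deleteVertex-disjoint E w disjoint) (deleteVertex-rainbowFree E w rainbowFree)

-- Each vertex w has a member all of whose edges touch w; by pigeonhole one member is
-- chosen by two vertices w₁ ≠ w₂, so it consists of the single edge w₁w₂.
singleEdgeMember : ∀ k (E : Fin (suc k) → Subgraph (suc (suc k))) →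
  (∀ c → IsEdgeSet (E c)) → (∀ c → Nonempty (E c)) → PairwiseEdgeDisjoint E → ¬ RainbowCycle E →
  ∃ λ c → ∃₂ λ w₁ w₂ → IsSingleEdge (E c) w₁ w₂
singleEdgeMember k E isEdgeSet nonempty disjoint rainbowFree =
  confined (pigeonhole (n<1+n _) (λ w → proj₁ (empties w)))
  where
  empties : ∀ w → ∃ λ d → ¬ Nonempty (deleteVertex E w d)
  empties = deleteVertex-empties-member k E isEdgeSet disjoint rainbowFree

  confined : (∃₂ λ w₁ w₂ → w₁ < w₂ × proj₁ (empties w₁) ≡ proj₁ (empties w₂)) →
    ∃ λ c → ∃₂ λ w₁ w₂ → IsSingleEdge (E c) w₁ w₂
  confined (w₁ , w₂ , w₁<w₂ , same) = c , w₁ , w₂ , w₁≢w₂ , w₁w₂∈c (nonempty c) , only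
    where
    c = proj₁ (empties w₁)
    w₁≢w₂ = <⇒≢ w₁<w₂

    only : ∀ {x y} → E c x y ≡ true → SameEdge w₁ w₂ x y
    only edge with deleteVertex-empty⇒touches E w₁ (proj₂ (empties w₁)) edge
                 | deleteVertex-empty⇒touches E w₂
                     (subst (λ d → ¬ Nonempty (deleteVertex E w₂ d)) (sym same) (proj₂ (empties w₂))) edge
    ... | inj₁ x≡w₁ | inj₁ x≡w₂ = ⊥-elim (w₁≢w₂ (trans (sym x≡w₁) x≡w₂))
    ... | inj₁ x≡w₁ | inj₂ y≡w₂ = inj₁ (x≡w₁ , y≡w₂)
    ... | inj₂ y≡w₁ | inj₁ x≡w₂ = inj₂ (x≡w₂ , y≡w₁)
    ... | inj₂ y≡w₁ | inj₂ y≡w₂ = ⊥-elim (w₁≢w₂ (trans (sym y≡w₁) y≡w₂))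

    w₁w₂∈c : Nonempty (E c) → E c w₁ w₂ ≡ true
    w₁w₂∈c (x , y , edge) with only edge
    ... | inj₁ (refl , refl) = edge
    ... | inj₂ (refl , refl) = edge-sym (isEdgeSet c) edge

monochromaticCut : ∀ k (E : Fin (suc k) → Subgraph (suc (suc k))) →
  (∀ c → IsEdgeSet (E c)) → (∀ c → Nonempty (E c)) → PairwiseEdgeDisjoint E → ¬ RainbowCycle E →
  MonochromaticCut E
monochromaticCut zero E isEdgeSet nonempty _ _ with nonempty zero
... | u , v , uv∈ =
  (λ x → does (x ≟ u)) , zero ,
  (u , v , uv∈ , dec-true (u ≟ u) refl , dec-false (v ≟ u) (λ v≡u → edge⇒≢ (isEdgeSet zero) uv∈ (sym v≡u))) ,
  λ { zero _ → refl }
monochromaticCut (suc k) E isEdgeSet nonempty disjoint rainbowFree =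
  contract (singleEdgeMember (suc k) E isEdgeSet nonempty disjoint rainbowFree)
  where
  contract : (∃ λ c → ∃₂ λ w₁ w₂ → IsSingleEdge (E c) w₁ w₂) → MonochromaticCut E
  contract (c , w₁ , w₂ , w₁≢w₂ , w₁w₂∈c , only) = pullback-cut only
    (monochromaticCut k Contracted contracted-isEdgeSet
      (λ d → contracted-nonempty d (nonempty (punchIn c d))) contracted-disjoint contracted-rainbowFree)
    where
    open Contraction E c w₁≢w₂
    open Properties isEdgeSet disjoint rainbowFree w₁w₂∈c

lemma4p4 : (n : ℕ) → n ≥ 1 → (E : Fin n → Subgraph (suc n)) →
    (∀ c → IsEdgeSet (E c)) → (∀ c → Nonempty (E c)) →
    PairwiseEdgeDisjoint E → ¬ RainbowCycle E → MonochromaticCut E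
lemma4p4 (suc k) _ = monochromaticCut k
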